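{- Let $k\ge1$, $n\ge1$, and let $P$ be a length-$n$ read-once branching program over alphabet $\{0,1\}^k$ of width $w$, with potential $\Phi_t$ as defined in the context. Write $N=\lfloor n/10\rfloor$. Then $\Phi_N\ge0$, and for every $N\le t\le n-1$, $$\Phi_{t+1}-\Phi_t\ \ge\ \left\lceil\tfrac{9k}{10}\right\rceil\cdot\left((N+1)^k-w\cdot2^k\cdot(N+1)^{\lceil 9k/10\rceil-1}\right).$$
   Context: A length-$n$ read-once branching program (ROBP) over alphabet $\Sigma$: layered multigraph with layers $V_0,\dots,V_n$, $V_0=\{v_{\mathrm{start}}\}$, each vertex of $V_i$ ($i<n$) having $|\Sigma|$ outgoing edges into $V_{i+1}$ labeled by distinct symbols, every vertex reachable by some input; an input follows from $v_{\mathrm{start}}$ the edges labeled $x_1,x_2,\dots$ and a prefix $(x_1,\dots,x_t)$ reaches the vertex of $V_t$ on that path. Width is $\max_i|V_i|$. For $v\in V_t$, $R(v)=[a_1,b_1]\times\cdots\times[a_k,b_k]$ where $a_j,b_j$ are the minimum and maximum of $\#\{i\in[t]:(x_i)_j=1\}$ over prefixes $(x_1,\dots,x_t)\in(\{0,1\}^k)^t$ reaching $v$; $\mathcal R_t=\{R(v):v\in V_t\}$. For $\lfloor n/10\rfloor\le t\le n$ and $x=(x_1,\dots,x_k)\in\{0,1,\dots,\lfloor n/10\rfloor\}^k$, $\phi_t(x)=\max\{b_1+\cdots+b_k-x_1-\cdots-x_k\}$ over all $R=[a_1,b_1]\times\cdots\times[a_k,b_k]\in\mathcal R_t$ with $x\in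 R$, and $\Phi_t=\sum_{x\in\{0,\dots,\lfloor n/10\rfloor\}^k}\phi_t(x)$. -}

module Defs where

open import Data.Bool using (Bool; true; false; if_then_else_; _∧_; T?)
open import Data.Bool.ListAction using (and)
open import Data.Nat.ListAction using (sum)
open import Data.Nat as ℕ using (ℕ; zero; suc; _+_; _*_; _∸_; _^_; _≤_; _<_; _≤ᵇ_; _⊔_; _⊓_)
open import Data.Nat.Properties using (<⇒≤)
open import Data.Nat.DivMod using (_/_; m/n≤m)
open import Data.Fin using (Fin; inject₁; fromℕ; _≟_)
open import Data.Vec using (Vec; []; _∷_; lookup)
import Data.Vec as Vec
open import Data.List as List using (List; []; _∷_; map; foldr; allFin; upTo; filter; cartesianProductWith)
open import Data.Integer as ℤ using (ℤ; +_)
open import Relation.Binary.PropositionalEquality using (_≡_)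

Sym : ℕ → Set
Sym k = Vec Bool k

-- Layer V_i is Fin (size i) for i ≤ n; V_0 has exactly one vertex (v_start).
-- Each vertex of V_i (i < n) has exactly one outgoing edge per symbol,
-- given by δ; distinct labels per vertex, multi-edges allowed.
record ROBP (n k : ℕ) : Set where
  field
    size  : ℕ → ℕ
    size0 : size 0 ≡ 1
    δ     : (i : ℕ) → i < n → Fin (size i) → Sym k → Fin (size (suc i))

  vstart : Fin (size 0)
  vstart rewrite size0 = Fin.zero
    where import Data.Fin as Fin

  -- the vertex of V_t reached by the prefix (x_1,…,x_t) (x i = x_{i+1})
  reach : (t : ℕ) → t ≤ n → (Fin t → Sym k) → Fin (size t)
  reach zero    _ x = vstart
  reach (suc t) h x = δ t h (reach t (<⇒≤ h) (λ i → x (inject₁ i))) (x (fromℕ t))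

  width : ℕ
  width = foldr _⊔_ 0 (map size (upTo (suc n)))

AllReachable : ∀ {n k} → ROBP n k → Set
AllReachable {n} {k} P = (t : ℕ) (h : t ≤ n) (v : Fin (ROBP.size P t)) →
  Σ (Fin t → Sym k) λ x → ROBP.reach P t h x ≡ v
  where open import Data.Product using (Σ)

vecsOver : ∀ {A : Set} → List A → (m : ℕ) → List (Vec A m)
vecsOver xs zero    = [] ∷ []
vecsOver xs (suc m) = cartesianProductWith _∷_ xs (vecsOver xs m)

prefixes : (k t : ℕ) → List (Fin t → Sym k)
prefixes k t = map lookup (vecsOver (vecsOver (true ∷ false ∷ []) k) t)

count : ∀ {k} (t : ℕ) → (Fin t → Sym k) → Fin k → ℕ
count t x j = sum (map (λ i → if lookup (x i) j then 1 else 0) (allFin t))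

-- maximum of a list of integers (the lists used below are nonempty)
maxℤ : List ℤ → ℤ
maxℤ []       = + 0
maxℤ (z ∷ zs) = foldr ℤ._⊔_ z zs

module Potential {n k : ℕ} (P : ROBP n k) where
  open ROBP P

  reaching : (t : ℕ) → t ≤ n → Fin (size t) → List (Fin t → Sym k)
  reaching t h v = filter (λ x → reach t h x ≟ v) (prefixes k t)

  -- R(v) = [a_1,b_1] × ⋯ × [a_k,b_k]  (min / max over the nonempty list of
  -- reaching prefixes; the default t for the min is never used under AllReachable)
  lo hi : (t : ℕ) → t ≤ n → Fin (size t) → Fin k → ℕ
  lo t h v j = foldr _⊓_ t (map (λ x → count t x j) (reaching t h v))
  hi t h v j = foldr _⊔_ 0 (map (λ x → count t x j) (reaching t h v))

  inR : (t : ℕ) → (h : t ≤ n) → Fin (size t) → Vec ℕ k → Bool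
  inR t h v x = and (map (λ j → (lo t h v j ≤ᵇ lookup x j) ∧ (lookup x j ≤ᵇ hi t h v j)) (allFin k))

  N : ℕ
  N = n / 10

  φ : (t : ℕ) → t ≤ n → Vec ℕ k → ℤ
  φ t h x = maxℤ (map (λ v → + (Vec.sum (Vec.tabulate (hi t h v))) ℤ.- + (Vec.sum x))
                      (filter (λ v → T? (inR t h v x)) (allFin (size t))))

  Φ : (t : ℕ) → t ≤ n → ℤ
  Φ t h = List.foldr ℤ._+_ (+ 0) (map (φ t h) (vecsOver (upTo (suc N)) k))

  N≤n : N ≤ n
  N≤n = m/n≤m n 10

ceil9k/10 : ℕ → ℕ
ceil9k/10 k = (9 * k + 9) / 10

module Submission where

-- Write a = (a_j) and b = (b_j) for the lower and upper corners of the box R(v). Every x with all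
-- x_j ≤ t lies in the box of the vertex reached by the prefix whose i-th symbol has bit j set iff
-- i < x_j, and b ≥ x on any box containing x; hence φ_t(x) ≥ 0. If x ∈ R(v), the edge out of v
-- labelled by the symbol with bit j set iff a_j ≠ x_j leads to a vertex whose box still contains x
-- and whose upper corner has grown by the Hamming distance d(a, x) in total, so φ_{t+1}(x) ≥ φ_t(x) + c
-- whenever every box of layer t containing x has d(a, x) ≥ c. A Hamming ball of radius less than c in
-- {0,…,N}^k has at most 2^k (N+1)^{c-1} points, so at most w 2^k (N+1)^{c-1} grid points miss this
-- gain of c, and summing over the grid gives the bound. Nothing here needs c = ⌈9k/10⌉, k ≥ 1 or n ≥ 1.

-- The development sits in an anonymous module so that its ℕ operators stay out of the scope of the
-- statement, whose unqualified operators are those of ℤ.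
module _ where

  open import Algebra.Properties.CommutativeSemigroup using (interchange; x∙yz≈y∙xz)
  open import Data.Bool using (Bool; true; false; T; not; if_then_else_)
  open import Data.Bool.Properties using (T-∧)
  open import Data.Fin as Fin using (Fin; inject₁; fromℕ; toℕ)
  open import Data.Integer as ℤ using (ℤ; +_)
  import Data.Integer.Properties as ℤ
  open import Data.Integer.Tactic.RingSolver using () renaming (solve-∀ to ℤ-solve-∀)
  open import Data.List using (List; []; _∷_; _++_; map; foldr; length; allFin; filter; upTo; cartesianProductWith)
  open import Data.List.Membership.Propositional using (_∈_)
  open import Data.List.Membership.Propositional.Properties
    using (∈-map⁺; ∈-filter⁺; ∈-filter⁻; ∈-allFin; ∈-upTo⁺; ∈-upTo⁻)
  open import Data.List.Properties
    using (map-++; map-cong; map-∘; map-tabulate; length-++; length-map; length-tabulate; length-upTo;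
           foldr-preservesᵇ; foldr-preservesᵒ)
  open import Data.List.Relation.Unary.All as All using (All; []; _∷_)
  import Data.List.Relation.Unary.All.Properties as All
  open import Data.List.Relation.Unary.AllPairs using ([]; _∷_)
  open import Data.List.Relation.Unary.Any as Any using (here; there)
  import Data.List.Relation.Unary.Any.Properties as Any
  open import Data.List.Relation.Unary.Unique.Propositional using (Unique)
  open import Data.List.Relation.Unary.Unique.Propositional.Properties using (upTo⁺)
  open import Data.Nat
    using (ℕ; zero; suc; _+_; _*_; _∸_; _^_; _≤_; _<_; _<ᵇ_; _≡ᵇ_; _⊔_; _⊓_; z≤n; s≤s; NonZero)
  open import Data.Nat.ListAction using (sum)
  open import Data.Nat.ListAction.Properties using (sum-++)
  open import Data.Nat.Properties
  open import Data.Nat.Tactic.RingSolver using (solve-∀)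
  open import Data.Product using (_×_; _,_; proj₁; proj₂; ∃)
  open import Data.Sum using (inj₂; [_,_]′)
  open import Data.Vec as Vec using (Vec; lookup)
  open import Data.Vec.Properties using (lookup∘tabulate; ∷-injective)
  open import Defs
  open import Function using (_∘_; const; id)
  open import Function.Bundles using (_⇔_; mk⇔; Equivalence)
  open import Relation.Binary.Definitions using (DecidableEquality)
  open import Relation.Binary.PropositionalEquality
  open import Relation.Nullary using (does; yes; no)
  open import Relation.Nullary.Decidable using (T?; dec-false)

  private variable
    A B C : Set

  𝟙 : Bool → ℕ
  𝟙 b = if b then 1 else 0

  𝟙≤1 : ∀ b → 𝟙 b ≤ 1
  𝟙≤1 true  = ≤-refl
  𝟙≤1 false = z≤n

  𝟙[<ᵇ]≡0⇒≥ : ∀ {a b} → 𝟙 (a <ᵇ b) ≡ 0 → b ≤ a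
  𝟙[<ᵇ]≡0⇒≥ {a} {b} eq with a <ᵇ b in a<ᵇb
  ... | false = ≮⇒≥ (λ a<b → subst T a<ᵇb (<⇒<ᵇ a<b))

  1≤𝟙[m≡ᵇ0]+m : ∀ m → 1 ≤ 𝟙 (m ≡ᵇ 0) + m
  1≤𝟙[m≡ᵇ0]+m zero    = ≤-refl
  1≤𝟙[m≡ᵇ0]+m (suc m) = s≤s z≤n

  ∑ : List A → (A → ℕ) → ℕ
  ∑ xs f = sum (map f xs)

  ∑-cong : ∀ (xs : List A) {f g : A → ℕ} → (∀ x → f x ≡ g x) → ∑ xs f ≡ ∑ xs g
  ∑-cong xs f≗g = cong sum (map-cong f≗g xs)

  ∑-mono : ∀ (xs : List A) {f g : A → ℕ} → (∀ {x} → x ∈ xs → f x ≤ g x) → ∑ xs f ≤ ∑ xs g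
  ∑-mono []       f≤g = z≤n
  ∑-mono (x ∷ xs) f≤g = +-mono-≤ (f≤g (here refl)) (∑-mono xs (f≤g ∘ there))

  ∑-++ : ∀ (xs ys : List A) f → ∑ (xs ++ ys) f ≡ ∑ xs f + ∑ ys f
  ∑-++ xs ys f = trans (cong sum (map-++ f xs ys)) (sum-++ (map f xs) (map f ys))

  ∑-distrib-+ : ∀ (xs : List A) f g → ∑ xs (λ x → f x + g x) ≡ ∑ xs f + ∑ xs g
  ∑-distrib-+ []       f g = refl
  ∑-distrib-+ (x ∷ xs) f g =
    trans (cong (_+_ (f x + g x)) (∑-distrib-+ xs f g)) (interchange +-commutativeSemigroup (f x) (g x) _ _)

  ∑-distribˡ-* : ∀ (xs : List A) c f → ∑ xs (λ x → c * f x) ≡ c * ∑ xs f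
  ∑-distribˡ-* []       c f = sym (*-zeroʳ c)
  ∑-distribˡ-* (x ∷ xs) c f =
    trans (cong (_+_ (c * f x)) (∑-distribˡ-* xs c f)) (sym (*-distribˡ-+ c (f x) _))

  ∑-const : ∀ (xs : List A) c → ∑ xs (const c) ≡ length xs * c
  ∑-const []       c = refl
  ∑-const (x ∷ xs) c = cong (_+_ c) (∑-const xs c)

  ∑≡0⇒ : ∀ (xs : List A) {f} → ∑ xs f ≡ 0 → ∀ {x} → x ∈ xs → f x ≡ 0
  ∑≡0⇒ (y ∷ xs) {f} eq (here refl) = m+n≡0⇒m≡0 (f y) eq
  ∑≡0⇒ (y ∷ xs) {f} eq (there x∈)  = ∑≡0⇒ xs (m+n≡0⇒n≡0 (f y) eq) x∈

  ∑-comm : ∀ (xs : List A) (ys : List B) (f : A → B → ℕ) →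
           ∑ xs (λ x → ∑ ys (f x)) ≡ ∑ ys (λ y → ∑ xs (λ x → f x y))
  ∑-comm []       ys f = sym (trans (∑-const ys 0) (*-zeroʳ (length ys)))
  ∑-comm (x ∷ xs) ys f =
    trans (cong (_+_ (∑ ys (f x))) (∑-comm xs ys f)) (sym (∑-distrib-+ ys (f x) _))

  ∑-cartesianProductWith : ∀ (_∙_ : A → B → C) xs ys f →
    ∑ (cartesianProductWith _∙_ xs ys) f ≡ ∑ xs (λ x → ∑ ys (λ y → f (x ∙ y)))
  ∑-cartesianProductWith _∙_ []       ys f = refl
  ∑-cartesianProductWith _∙_ (x ∷ xs) ys f = begin
    ∑ (map (x ∙_) ys ++ cartesianProductWith _∙_ xs ys) f
      ≡⟨ ∑-++ (map (x ∙_) ys) _ f ⟩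
    ∑ (map (x ∙_) ys) f + ∑ (cartesianProductWith _∙_ xs ys) f
      ≡⟨ cong₂ _+_ (cong sum (sym (map-∘ {g = f} {f = x ∙_} ys))) (∑-cartesianProductWith _∙_ xs ys f) ⟩
    ∑ ys (λ y → f (x ∙ y)) + ∑ xs (λ x → ∑ ys (λ y → f (x ∙ y))) ∎
    where open ≡-Reasoning

  ∑-allFin-suc : ∀ n (f : Fin (suc n) → ℕ) →
                 ∑ (allFin (suc n)) f ≡ f Fin.zero + ∑ (allFin n) (f ∘ Fin.suc)
  ∑-allFin-suc n f =
    cong (_+_ (f Fin.zero)) (cong sum (trans (map-tabulate Fin.suc f) (sym (map-tabulate id (f ∘ Fin.suc)))))

  ∑-allFin-sucʳ : ∀ n (f : Fin (suc n) → ℕ) →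
                  ∑ (allFin (suc n)) f ≡ ∑ (allFin n) (f ∘ inject₁) + f (fromℕ n)
  ∑-allFin-sucʳ zero    f = +-comm (f Fin.zero) 0
  ∑-allFin-sucʳ (suc n) f = begin
    ∑ (allFin (suc (suc n))) f
      ≡⟨ ∑-allFin-suc (suc n) f ⟩
    f Fin.zero + ∑ (allFin (suc n)) (f ∘ Fin.suc)
      ≡⟨ cong (_+_ (f Fin.zero)) (∑-allFin-sucʳ n (f ∘ Fin.suc)) ⟩
    f Fin.zero + (∑ (allFin n) (f ∘ inject₁ ∘ Fin.suc) + f (fromℕ (suc n)))
      ≡⟨ +-assoc (f Fin.zero) _ _ ⟨
    f Fin.zero + ∑ (allFin n) (f ∘ inject₁ ∘ Fin.suc) + f (fromℕ (suc n))
      ≡⟨ cong (_+ f (fromℕ (suc n))) (∑-allFin-suc n (f ∘ inject₁)) ⟨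
    ∑ (allFin (suc n)) (f ∘ inject₁) + f (fromℕ (suc n)) ∎
    where open ≡-Reasoning

  sum-lookup : ∀ {n} (x : Vec ℕ n) → Vec.sum x ≡ ∑ (allFin n) (lookup x)
  sum-lookup Vec.[]       = refl
  sum-lookup (a Vec.∷ as) = trans (cong (_+_ a) (sum-lookup as)) (sym (∑-allFin-suc _ (lookup (a Vec.∷ as))))

  sum-tabulate : ∀ {n} (f : Fin n → ℕ) → Vec.sum (Vec.tabulate f) ≡ ∑ (allFin n) f
  sum-tabulate {n} f = trans (sum-lookup (Vec.tabulate f)) (∑-cong (allFin n) (lookup∘tabulate f))

  ∈-vecsOver⁻ : ∀ {L : List A} {m} {x : Vec A m} → x ∈ vecsOver L m → ∀ i → lookup x i ∈ L
  ∈-vecsOver⁻ {L = L} {suc m} {y Vec.∷ ys} x∈ i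
    with y∈L , ys∈ ← Any.cartesianProductWith⁻ Vec._∷_ {P = y ≡_} {Q = ys ≡_} ∷-injective
                                                L (vecsOver L m) x∈
    with i
  ... | Fin.zero  = y∈L
  ... | Fin.suc i = ∈-vecsOver⁻ ys∈ i

  ∈-vecsOver⁺ : ∀ {L : List A} {m} {x : Vec A m} → (∀ i → lookup x i ∈ L) → x ∈ vecsOver L m
  ∈-vecsOver⁺ {m = zero}  {Vec.[]}     _   = here refl
  ∈-vecsOver⁺ {m = suc m} {y Vec.∷ ys} x∈L =
    Any.cartesianProductWith⁺ Vec._∷_ (cong₂ Vec._∷_) (x∈L Fin.zero) (∈-vecsOver⁺ (x∈L ∘ Fin.suc))

  length-cartesianProductWith : ∀ (_∙_ : A → B → C) xs ys →
    length (cartesianProductWith _∙_ xs ys) ≡ length xs * length ys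
  length-cartesianProductWith _∙_ []       ys = refl
  length-cartesianProductWith _∙_ (x ∷ xs) ys = begin
    length (map (x ∙_) ys ++ cartesianProductWith _∙_ xs ys)
      ≡⟨ length-++ (map (x ∙_) ys) ⟩
    length (map (x ∙_) ys) + length (cartesianProductWith _∙_ xs ys)
      ≡⟨ cong₂ _+_ (length-map (x ∙_) ys) (length-cartesianProductWith _∙_ xs ys) ⟩
    length ys + length xs * length ys ∎
    where open ≡-Reasoning

  length-vecsOver : ∀ (L : List A) m → length (vecsOver L m) ≡ length L ^ m
  length-vecsOver L zero    = refl
  length-vecsOver L (suc m) =
    trans (length-cartesianProductWith Vec._∷_ L (vecsOver L m)) (cong (length L *_) (length-vecsOver L m))

  module Hamming (_≟_ : DecidableEquality A) where

    hamming : ∀ {m} → Vec A m → Vec A m → ℕ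
    hamming {m} a x = ∑ (allFin m) (λ j → 𝟙 (not (does (lookup a j ≟ lookup x j))))

    hamming-∷ : ∀ {m} a y (as xs : Vec A m) →
                hamming (a Vec.∷ as) (y Vec.∷ xs) ≡ 𝟙 (not (does (a ≟ y))) + hamming as xs
    hamming-∷ {m} a y as xs =
      ∑-allFin-suc m (λ j → 𝟙 (not (does (lookup (a Vec.∷ as) j ≟ lookup (y Vec.∷ xs) j))))

    ballCard : List A → ∀ {m} → Vec A m → ℕ → ℕ
    ballCard L {m} a r = ∑ (vecsOver L m) (λ x → 𝟙 (hamming a x <ᵇ r))

    ballCard-0 : ∀ L {m} (a : Vec A m) → ballCard L a 0 ≡ 0
    ballCard-0 L {m} a = trans (∑-const (vecsOver L m) 0) (*-zeroʳ (length (vecsOver L m)))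

    ∑-𝟙[≟]-∉ : ∀ a {L} → All (a ≢_) L → ∑ L (λ y → 𝟙 (does (a ≟ y))) ≡ 0
    ∑-𝟙[≟]-∉ a []          = refl
    ∑-𝟙[≟]-∉ a (a≢y ∷ a∉L) rewrite dec-false (a ≟ _) a≢y = ∑-𝟙[≟]-∉ a a∉L

    ∑-𝟙[≟]-unique : ∀ a {L} → Unique L → ∑ L (λ y → 𝟙 (does (a ≟ y))) ≤ 1
    ∑-𝟙[≟]-unique a [] = z≤n
    ∑-𝟙[≟]-unique a {y ∷ L} (y∉L ∷ L-unique) with a ≟ y
    ... | yes refl = ≤-reflexive (cong suc (∑-𝟙[≟]-∉ a y∉L))
    ... | no _     = ∑-𝟙[≟]-unique a L-unique

    ballCard-∷-slice : ∀ L {m} a (as : Vec A m) r y →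
      ∑ (vecsOver L m) (λ xs → 𝟙 (hamming (a Vec.∷ as) (y Vec.∷ xs) <ᵇ r))
        ≤ 𝟙 (does (a ≟ y)) * ballCard L as r + ballCard L as (r ∸ 1)
    ballCard-∷-slice L {m} a as r y
      rewrite ∑-cong (vecsOver L m) (λ xs → cong (λ d → 𝟙 (d <ᵇ r)) (hamming-∷ a y as xs))
      with a ≟ y
    ... | yes _ = ≤-trans (m≤m+n (ballCard L as r) _)
                          (+-monoˡ-≤ _ (≤-reflexive (sym (*-identityˡ (ballCard L as r)))))
    ... | no _  = ≤-reflexive (∑-cong (vecsOver L m) (λ xs → cong 𝟙 (suc<ᵇ (hamming as xs) r)))
      where
      suc<ᵇ : ∀ d r → (suc d <ᵇ r) ≡ (d <ᵇ r ∸ 1)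
      suc<ᵇ d zero    = refl
      suc<ᵇ d (suc r) = refl

    ballCard-∷ : ∀ {L} → Unique L → ∀ {m} a (as : Vec A m) r →
      ballCard L (a Vec.∷ as) r ≤ ballCard L as r + length L * ballCard L as (r ∸ 1)
    ballCard-∷ {L} L-unique {m} a as r = begin
      ballCard L (a Vec.∷ as) r
        ≡⟨ ∑-cartesianProductWith Vec._∷_ L (vecsOver L m) _ ⟩
      ∑ L (λ y → ∑ (vecsOver L m) (λ xs → 𝟙 (hamming (a Vec.∷ as) (y Vec.∷ xs) <ᵇ r)))
        ≤⟨ ∑-mono L (λ {y} _ → ballCard-∷-slice L a as r y) ⟩
      ∑ L (λ y → 𝟙 (does (a ≟ y)) * same + shifted)
        ≡⟨ ∑-distrib-+ L _ _ ⟩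
      ∑ L (λ y → 𝟙 (does (a ≟ y)) * same) + ∑ L (const shifted)
        ≡⟨ cong₂ _+_ (trans (∑-cong L (λ y → *-comm _ same)) (∑-distribˡ-* L same _))
                     (∑-const L shifted) ⟩
      same * ∑ L (λ y → 𝟙 (does (a ≟ y))) + length L * shifted
        ≤⟨ +-monoˡ-≤ _ (≤-trans (*-monoʳ-≤ same (∑-𝟙[≟]-unique a L-unique))
                                (≤-reflexive (*-identityʳ same))) ⟩
      same + length L * shifted ∎
      where
      open ≤-Reasoning
      same shifted : ℕ
      same    = ballCard L as r
      shifted = ballCard L as (r ∸ 1)

    ballCard≤ : ∀ {L} → Unique L → .{{_ : NonZero (length L)}} → ∀ {m} (a : Vec A m) r →
      ballCard L a r ≤ 2 ^ m * length L ^ (r ∸ 1)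
    ballCard≤ {L} L-unique Vec.[] r = +-monoˡ-≤ 0 (≤-trans (𝟙≤1 (0 <ᵇ r)) (m^n>0 (length L) (r ∸ 1)))
    ballCard≤ {L} L-unique (a Vec.∷ as) zero = ≤-trans (≤-reflexive (ballCard-0 L (a Vec.∷ as))) z≤n
    ballCard≤ {L} L-unique {suc m} (a Vec.∷ as) (suc r) = begin
      ballCard L (a Vec.∷ as) (suc r)              ≤⟨ ballCard-∷ L-unique a as (suc r) ⟩
      ballCard L as (suc r) + M * ballCard L as r  ≤⟨ +-mono-≤ (ballCard≤ L-unique as (suc r)) (M*ballCard≤ r) ⟩
      2 ^ m * M ^ r + 2 ^ m * M ^ r               ≡⟨ x*y+x*y≡2*x*y (2 ^ m) (M ^ r) ⟩
      2 ^ suc m * M ^ r                            ∎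
      where
      open ≤-Reasoning
      M : ℕ
      M = length L
      x*y+x*y≡2*x*y : ∀ x y → x * y + x * y ≡ 2 * x * y
      x*y+x*y≡2*x*y = solve-∀
      M*ballCard≤ : ∀ r → M * ballCard L as r ≤ 2 ^ m * M ^ r
      M*ballCard≤ zero    = ≤-trans (≤-reflexive (trans (cong (M *_) (ballCard-0 L as)) (*-zeroʳ M))) z≤n
      M*ballCard≤ (suc r) = ≤-trans (*-monoʳ-≤ M (ballCard≤ L-unique as (suc r)))
                                    (≤-reflexive (x∙yz≈y∙xz *-commutativeSemigroup M (2 ^ m) (M ^ r)))

  ∈⇒≤foldr-⊔ : ∀ {y} b {xs} → y ∈ xs → y ≤ foldr _⊔_ b xs
  ∈⇒≤foldr-⊔ {y} b {xs} y∈xs = foldr-preservesᵒ {P = y ≤_}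
    (λ x z → [ (λ y≤x → ≤-trans y≤x (m≤m⊔n x z)) , (λ y≤z → ≤-trans y≤z (m≤n⊔m x z)) ]′)
    b xs (inj₂ (Any.map ≤-reflexive y∈xs))

  ∈⇒foldr-⊓≤ : ∀ {y} b {xs} → y ∈ xs → foldr _⊓_ b xs ≤ y
  ∈⇒foldr-⊓≤ {y} b {xs} y∈xs = foldr-preservesᵒ {P = _≤ y}
    (λ x z → [ (λ x≤y → ≤-trans (m⊓n≤m x z) x≤y) , (λ z≤y → ≤-trans (m⊓n≤n x z) z≤y) ]′)
    b xs (inj₂ (Any.map (≤-reflexive ∘ sym) y∈xs))

  foldr-⊔+≤ : ∀ {b e B xs} → b + e ≤ B → All (λ y → y + e ≤ B) xs → foldr _⊔_ b xs + e ≤ B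
  foldr-⊔+≤ {e = e} {B} = foldr-preservesᵇ {P = λ y → y + e ≤ B}
    (λ {x} {y} x+e≤B y+e≤B → subst (_≤ B) (sym (+-distribʳ-⊔ e x y)) (⊔-lub x+e≤B y+e≤B))

  ≤foldr-⊓+ : ∀ {b e B xs} → B ≤ b + e → All (λ y → B ≤ y + e) xs → B ≤ foldr _⊓_ b xs + e
  ≤foldr-⊓+ {e = e} {B} = foldr-preservesᵇ {P = λ y → B ≤ y + e}
    (λ {x} {y} B≤x+e B≤y+e → subst (B ≤_) (sym (+-distribʳ-⊓ e x y)) (⊓-glb B≤x+e B≤y+e))

  ∈⇒≤maxℤ : ∀ {z zs} → z ∈ zs → z ℤ.≤ maxℤ zs
  ∈⇒≤maxℤ {z} {w ∷ ws} z∈ = foldr-preservesᵒ {P = z ℤ.≤_}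
    (λ x y → [ (λ z≤x → ℤ.≤-trans z≤x (ℤ.i≤i⊔j x y))
             , (λ z≤y → ℤ.≤-trans z≤y (ℤ.i≤j⊔i x y)) ]′)
    w ws (Any.toSum (Any.map ℤ.≤-reflexive z∈))

  maxℤ+≤ : ∀ {z zs k B} → z ∈ zs → All (λ y → y ℤ.+ k ℤ.≤ B) zs → maxℤ zs ℤ.+ k ℤ.≤ B
  maxℤ+≤ {zs = w ∷ ws} {k} {B} _ (w+k≤B ∷ ws+k≤B) = foldr-preservesᵇ {P = λ y → y ℤ.+ k ℤ.≤ B}
    (λ {x} {y} x+k≤B y+k≤B →
      ℤ.≤-trans (ℤ.≤-reflexive (ℤ.mono-≤-distrib-⊔ (ℤ.+-monoˡ-≤ k) x y)) (ℤ.⊔-lub x+k≤B y+k≤B))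
    w+k≤B ws+k≤B

  ∑ℤ : List A → (A → ℤ) → ℤ
  ∑ℤ xs f = foldr ℤ._+_ (+ 0) (map f xs)

  ∑ℤ-nonNeg : ∀ (xs : List A) {f} → (∀ {x} → x ∈ xs → + 0 ℤ.≤ f x) → + 0 ℤ.≤ ∑ℤ xs f
  ∑ℤ-nonNeg []       0≤f = ℤ.≤-refl
  ∑ℤ-nonNeg (x ∷ xs) 0≤f = ℤ.+-mono-≤ (0≤f (here refl)) (∑ℤ-nonNeg xs (0≤f ∘ there))

  ∑ℤ-+-mono : ∀ (xs : List A) {f g d} → (∀ {x} → x ∈ xs → f x ℤ.+ + d x ℤ.≤ g x) →
    ∑ℤ xs f ℤ.+ + ∑ xs d ℤ.≤ ∑ℤ xs g
  ∑ℤ-+-mono []       f+d≤g = ℤ.≤-refl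
  ∑ℤ-+-mono (x ∷ xs) {f} {g} {d} f+d≤g = begin
    f x ℤ.+ ∑ℤ xs f ℤ.+ + (d x + ∑ xs d)
      ≡⟨ cong (ℤ._+_ (f x ℤ.+ ∑ℤ xs f)) (ℤ.pos-+ (d x) (∑ xs d)) ⟩
    f x ℤ.+ ∑ℤ xs f ℤ.+ (+ d x ℤ.+ + ∑ xs d)
      ≡⟨ interchange ℤ.+-commutativeSemigroup (f x) (∑ℤ xs f) (+ d x) (+ ∑ xs d) ⟩
    f x ℤ.+ + d x ℤ.+ (∑ℤ xs f ℤ.+ + ∑ xs d)
      ≤⟨ ℤ.+-mono-≤ (f+d≤g (here refl)) (∑ℤ-+-mono xs (f+d≤g ∘ there)) ⟩
    g x ℤ.+ ∑ℤ xs g ∎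
    where open ℤ.≤-Reasoning

  i≤j+k⇒i-k≤j : ∀ {i j k} → i ℤ.≤ j ℤ.+ k → i ℤ.- k ℤ.≤ j
  i≤j+k⇒i-k≤j {i} {j} {k} i≤j+k =
    ℤ.≤-trans (ℤ.+-monoˡ-≤ (ℤ.- k) i≤j+k) (ℤ.≤-reflexive ([j+k]-k≡j j k))
    where
    [j+k]-k≡j : ∀ j k → j ℤ.+ k ℤ.- k ≡ j
    [j+k]-k≡j = ℤ-solve-∀

  i+j≤k⇒j≤k-i : ∀ {i j k} → i ℤ.+ j ℤ.≤ k → j ℤ.≤ k ℤ.- i
  i+j≤k⇒j≤k-i {i} {j} {k} i+j≤k =
    ℤ.≤-trans (ℤ.≤-reflexive (j≡[i+j]-i i j)) (ℤ.+-monoˡ-≤ (ℤ.- i) i+j≤k)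
    where
    j≡[i+j]-i : ∀ i j → j ≡ i ℤ.+ j ℤ.- i
    j≡[i+j]-i = ℤ-solve-∀

  snoc : ∀ {t} → (Fin t → A) → A → Fin (suc t) → A
  snoc {t = zero}  q s _           = s
  snoc {t = suc t} q s Fin.zero    = q Fin.zero
  snoc {t = suc t} q s (Fin.suc i) = snoc (q ∘ Fin.suc) s i

  snoc-inject₁ : ∀ {t} (q : Fin t → A) s i → snoc q s (inject₁ i) ≡ q i
  snoc-inject₁ q s Fin.zero    = refl
  snoc-inject₁ q s (Fin.suc i) = snoc-inject₁ (q ∘ Fin.suc) s i

  snoc-fromℕ : ∀ {t} (q : Fin t → A) s → snoc q s (fromℕ t) ≡ s
  snoc-fromℕ {t = zero}  q s = refl
  snoc-fromℕ {t = suc t} q s = snoc-fromℕ (q ∘ Fin.suc) s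

  module _ {k : ℕ} where

    count-cong : ∀ t {q q′ : Fin t → Sym k} → (∀ i → q i ≡ q′ i) →
                 ∀ j → count t q j ≡ count t q′ j
    count-cong t q≗q′ j = ∑-cong (allFin t) (λ i → cong (λ y → 𝟙 (lookup y j)) (q≗q′ i))

    count≤ : ∀ t (q : Fin t → Sym k) j → count t q j ≤ t
    count≤ t q j = begin
      count t q j             ≤⟨ ∑-mono (allFin t) (λ {i} _ → 𝟙≤1 (lookup (q i) j)) ⟩
      ∑ (allFin t) (const 1)  ≡⟨ ∑-const (allFin t) 1 ⟩
      length (allFin t) * 1   ≡⟨ trans (*-identityʳ _) (length-tabulate id) ⟩
      t                       ∎
      where open ≤-Reasoning

    count-snoc : ∀ t (q : Fin t → Sym k) s j → count (suc t) (snoc q s) j ≡ count t q j + 𝟙 (lookup s j)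
    count-snoc t q s j = begin
      count (suc t) (snoc q s) j
        ≡⟨ ∑-allFin-sucʳ t (λ i → 𝟙 (lookup (snoc q s i) j)) ⟩
      ∑ (allFin t) (λ i → 𝟙 (lookup (snoc q s (inject₁ i)) j)) + 𝟙 (lookup (snoc q s (fromℕ t)) j)
        ≡⟨ cong₂ _+_ (count-cong t (snoc-inject₁ q s) j) (cong (λ y → 𝟙 (lookup y j)) (snoc-fromℕ q s)) ⟩
      count t q j + 𝟙 (lookup s j) ∎
      where open ≡-Reasoning

    threshold : ∀ t → Vec ℕ k → Fin t → Sym k
    threshold t x i = Vec.tabulate (λ j → toℕ i <ᵇ lookup x j)

    count-threshold : ∀ t (x : Vec ℕ k) j → lookup x j ≤ t → count t (threshold t x) j ≡ lookup x j
    count-threshold t x j x≤t = trans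
      (∑-cong (allFin t) (λ i → cong 𝟙 (lookup∘tabulate (λ j → toℕ i <ᵇ lookup x j) j)))
      (∑-allFin-<ᵇ t x≤t)
      where
      ∑-allFin-<ᵇ : ∀ t {a} → a ≤ t → ∑ (allFin t) (λ i → 𝟙 (toℕ i <ᵇ a)) ≡ a
      ∑-allFin-<ᵇ t {zero} _ = trans (∑-const (allFin t) 0) (*-zeroʳ (length (allFin t)))
      ∑-allFin-<ᵇ (suc t) {suc a} (s≤s a≤t) =
        trans (∑-allFin-suc t (λ i → 𝟙 (toℕ i <ᵇ suc a))) (cong suc (∑-allFin-<ᵇ t a≤t))

    ∈-prefixes : ∀ t (q : Fin t → Sym k) → ∃ λ q′ → q′ ∈ prefixes k t × (∀ i → q′ i ≡ q i)
    ∈-prefixes t q =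
      lookup (Vec.tabulate q) ,
      ∈-map⁺ lookup (∈-vecsOver⁺ {x = Vec.tabulate q} (λ i → ∈-vecsOver⁺ (λ j → ∈-bits _))) ,
      lookup∘tabulate q
      where
      ∈-bits : ∀ b → b ∈ true ∷ false ∷ []
      ∈-bits true  = here refl
      ∈-bits false = there (here refl)

  module Boxes {n k : ℕ} (P : ROBP n k) (reachable : AllReachable P) where
    open ROBP P
    open Potential P

    reach-cong : ∀ t (h : t ≤ n) {q q′ : Fin t → Sym k} → (∀ i → q i ≡ q′ i) →
                 reach t h q ≡ reach t h q′
    reach-cong zero    h q≗q′ = refl
    reach-cong (suc t) h q≗q′ =
      cong₂ (δ t h) (reach-cong t (<⇒≤ h) (q≗q′ ∘ inject₁)) (q≗q′ (fromℕ t))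

    ∈-reaching⁻ : ∀ t (h : t ≤ n) {u q} → q ∈ reaching t h u → reach t h q ≡ u
    ∈-reaching⁻ t h {u} q∈ = proj₂ (∈-filter⁻ (λ x → reach t h x Fin.≟ u) {xs = prefixes k t} q∈)

    -- q itself need not occur in the list [prefixes k t], but an extensionally equal prefix does
    reaching-complete : ∀ t (h : t ≤ n) q →
                        ∃ λ q′ → q′ ∈ reaching t h (reach t h q) × (∀ i → q′ i ≡ q i)
    reaching-complete t h q with q′ , q′∈ , q′≗q ← ∈-prefixes t q =
      q′ , ∈-filter⁺ (λ x → reach t h x Fin.≟ reach t h q) q′∈ (reach-cong t h q′≗q) , q′≗q

    reaching-nonempty : ∀ t (h : t ≤ n) u → ∃ λ q → q ∈ reaching t h u
    reaching-nonempty t h u with x , refl ← reachable t h u with q , q∈ , _ ← reaching-complete t h x = q , q∈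

    lo≤count : ∀ t (h : t ≤ n) {u q} → q ∈ reaching t h u → ∀ j → lo t h u j ≤ count t q j
    lo≤count t h q∈ j = ∈⇒foldr-⊓≤ t (∈-map⁺ (λ x → count t x j) q∈)

    count≤hi : ∀ t (h : t ≤ n) {u q} → q ∈ reaching t h u → ∀ j → count t q j ≤ hi t h u j
    count≤hi t h q∈ j = ∈⇒≤foldr-⊔ 0 (∈-map⁺ (λ x → count t x j) q∈)

    InBox : ∀ t → t ≤ n → Fin (size t) → Vec ℕ k → Set
    InBox t h v x = ∀ j → lo t h v j ≤ lookup x j × lookup x j ≤ hi t h v j

    inR⇔InBox : ∀ t (h : t ≤ n) v x → T (inR t h v x) ⇔ InBox t h v x
    inR⇔InBox t h v x = mk⇔
      (λ x∈R j → let lo≤ , ≤hi = Equivalence.to T-∧ (All.lookup (All.all⁺ _ (allFin k) x∈R) (∈-allFin j))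
                 in ≤ᵇ⇒≤ _ _ lo≤ , ≤ᵇ⇒≤ _ _ ≤hi)
      (λ x∈v → All.all⁻ _ (All.tabulate⁺ λ j →
        Equivalence.from T-∧ (≤⇒≤ᵇ (proj₁ (x∈v j)) , ≤⇒≤ᵇ (proj₂ (x∈v j)))))

    box-covers : ∀ t (h : t ≤ n) x → (∀ j → lookup x j ≤ t) → ∃ λ u → InBox t h u x
    box-covers t h x x≤t with q , q∈ , q≗ ← reaching-complete t h (threshold t x) =
      reach t h (threshold t x) , λ j →
        subst (λ c → lo t h _ j ≤ c × c ≤ hi t h _ j) (count-q j) (lo≤count t h q∈ j , count≤hi t h q∈ j)
      where
      count-q : ∀ j → count t q j ≡ lookup x j
      count-q j = trans (count-cong t q≗ j) (count-threshold t x j (x≤t j))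

    slack : ∀ t → t ≤ n → Vec ℕ k → Fin (size t) → ℤ
    slack t h x v = + Vec.sum (Vec.tabulate (hi t h v)) ℤ.- + Vec.sum x

    0≤slack : ∀ t (h : t ≤ n) v x → InBox t h v x → + 0 ℤ.≤ slack t h x v
    0≤slack t h v x x∈v = ℤ.i≤j⇒0≤j-i (ℤ.+≤+ (begin
      Vec.sum x                          ≡⟨ sum-lookup x ⟩
      ∑ (allFin k) (lookup x)            ≤⟨ ∑-mono (allFin k) (λ {j} _ → proj₂ (x∈v j)) ⟩
      ∑ (allFin k) (hi t h v)            ≡⟨ sum-tabulate (hi t h v) ⟨
      Vec.sum (Vec.tabulate (hi t h v))  ∎))
      where open ≤-Reasoning

    candidate : ∀ t (h : t ≤ n) v x → InBox t h v x →
                v ∈ filter (λ u → T? (inR t h u x)) (allFin (size t))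
    candidate t h v x x∈v =
      ∈-filter⁺ (λ u → T? (inR t h u x)) (∈-allFin v) (Equivalence.from (inR⇔InBox t h v x) x∈v)

    slack≤φ : ∀ t (h : t ≤ n) v x → InBox t h v x → slack t h x v ℤ.≤ φ t h x
    slack≤φ t h v x x∈v = ∈⇒≤maxℤ (∈-map⁺ (slack t h x) (candidate t h v x x∈v))

    φ+≤ : ∀ t (h : t ≤ n) v x {c B} → InBox t h v x →
      (∀ u → InBox t h u x → slack t h x u ℤ.+ c ℤ.≤ B) → φ t h x ℤ.+ c ℤ.≤ B
    φ+≤ t h v x x∈v bound = maxℤ+≤ (∈-map⁺ (slack t h x) (candidate t h v x x∈v))
      (All.map⁺ (All.tabulate λ {u} u∈ → bound u (Equivalence.to (inR⇔InBox t h u x)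
        (proj₂ (∈-filter⁻ (λ u → T? (inR t h u x)) {xs = allFin (size t)} u∈)))))

    φ-nonNeg : ∀ t (h : t ≤ n) x → (∀ j → lookup x j ≤ t) → + 0 ℤ.≤ φ t h x
    φ-nonNeg t h x x≤t with u , x∈u ← box-covers t h x x≤t =
      ℤ.≤-trans (0≤slack t h u x x∈u) (slack≤φ t h u x x∈u)

    size≤width : ∀ t → t ≤ n → size t ≤ width
    size≤width t h = ∈⇒≤foldr-⊔ 0 (∈-map⁺ size (∈-upTo⁺ (s≤s h)))

    grid : List (Vec ℕ k)
    grid = vecsOver (upTo (suc N)) k

    grid≤N : ∀ {x} → x ∈ grid → ∀ j → lookup x j ≤ N
    grid≤N x∈ j = ≤-pred (∈-upTo⁻ (∈-vecsOver⁻ x∈ j))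

    Φ-nonNeg : + 0 ℤ.≤ Φ N N≤n
    Φ-nonNeg = ∑ℤ-nonNeg grid (λ {x} x∈ → φ-nonNeg N N≤n x (grid≤N x∈))

    module Step (t : ℕ) (t<n : t < n) where

      t≤n : t ≤ n
      t≤n = <⇒≤ t<n

      reaching-extend : ∀ {u q} → q ∈ reaching t t≤n u → ∀ s →
        ∃ λ q′ → q′ ∈ reaching (suc t) t<n (δ t t<n u s)
               × (∀ j → count (suc t) q′ j ≡ count t q j + 𝟙 (lookup s j))
      reaching-extend {u} {q} q∈ s
        with q′ , q′∈ , q′≗ ← reaching-complete (suc t) t<n (snoc q s)
        rewrite reach-cong t t≤n (snoc-inject₁ q s) | snoc-fromℕ q s | ∈-reaching⁻ t t≤n q∈ =
        q′ , q′∈ , λ j → trans (count-cong (suc t) q′≗ j) (count-snoc t q s j)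

      hi-δ : ∀ u s j → hi t t≤n u j + 𝟙 (lookup s j) ≤ hi (suc t) t<n (δ t t<n u s) j
      hi-δ u s j with q , q∈ ← reaching-nonempty t t≤n u =
        foldr-⊔+≤ (≤-trans (m≤n+m _ _) (extended≤hi q∈)) (All.map⁺ (All.tabulate extended≤hi))
        where
        extended≤hi : ∀ {q} → q ∈ reaching t t≤n u →
                      count t q j + 𝟙 (lookup s j) ≤ hi (suc t) t<n (δ t t<n u s) j
        extended≤hi q∈ with q′ , q′∈ , count-q′ ← reaching-extend q∈ s =
          subst (_≤ hi (suc t) t<n (δ t t<n u s) j) (count-q′ j) (count≤hi (suc t) t<n q′∈ j)

      lo-δ : ∀ u s j → lo (suc t) t<n (δ t t<n u s) j ≤ lo t t≤n u j + 𝟙 (lookup s j)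
      lo-δ u s j with q , q∈ ← reaching-nonempty t t≤n u =
        ≤foldr-⊓+ (≤-trans (lo≤extended q∈) (+-monoˡ-≤ _ (count≤ t q j)))
                  (All.map⁺ (All.tabulate lo≤extended))
        where
        lo≤extended : ∀ {q} → q ∈ reaching t t≤n u →
                      lo (suc t) t<n (δ t t<n u s) j ≤ count t q j + 𝟙 (lookup s j)
        lo≤extended q∈ with q′ , q′∈ , count-q′ ← reaching-extend q∈ s =
          subst (lo (suc t) t<n (δ t t<n u s) j ≤_) (count-q′ j) (lo≤count (suc t) t<n q′∈ j)

      open Hamming _≟_

      corner : Fin (size t) → Vec ℕ k
      corner v = Vec.tabulate (lo t t≤n v)

      towards : Fin (size t) → Vec ℕ k → Sym k
      towards v x = Vec.tabulate (λ j → not (lo t t≤n v j ≡ᵇ lookup x j))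

      next : Fin (size t) → Vec ℕ k → Fin (size (suc t))
      next v x = δ t t<n v (towards v x)

      hamming-corner : ∀ v x → hamming (corner v) x ≡ ∑ (allFin k) (λ j → 𝟙 (lookup (towards v x) j))
      hamming-corner v x = ∑-cong (allFin k) λ j →
        trans (cong (λ a → 𝟙 (not (a ≡ᵇ lookup x j))) (lookup∘tabulate (lo t t≤n v) j))
              (sym (cong 𝟙 (lookup∘tabulate (λ j → not (lo t t≤n v j ≡ᵇ lookup x j)) j)))

      InBox-next : ∀ v x → InBox t t≤n v x → InBox (suc t) t<n (next v x) x
      InBox-next v x x∈v j =
        ≤-trans (lo-δ v (towards v x) j)
                (subst (λ b → lo t t≤n v j + 𝟙 b ≤ lookup x j) (sym (lookup∘tabulate _ j))
                       (+𝟙[≢]≤ (proj₁ (x∈v j)))) ,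
        ≤-trans (proj₂ (x∈v j)) (≤-trans (m≤m+n _ _) (hi-δ v (towards v x) j))
        where
        +𝟙[≢]≤ : ∀ {a b} → a ≤ b → a + 𝟙 (not (a ≡ᵇ b)) ≤ b
        +𝟙[≢]≤ {a} {b} a≤b with a ≡ᵇ b in a≡ᵇb
        ... | true  = ≤-trans (≤-reflexive (+-identityʳ a)) a≤b
        ... | false = ≤-trans (≤-reflexive (+-comm a 1))
                              (≤∧≢⇒< a≤b (λ a≡b → subst T a≡ᵇb (≡⇒≡ᵇ a b a≡b)))

      sum-hi-next : ∀ v x →
        Vec.sum (Vec.tabulate (hi t t≤n v)) + hamming (corner v) x
          ≤ Vec.sum (Vec.tabulate (hi (suc t) t<n (next v x)))
      sum-hi-next v x = begin
        Vec.sum (Vec.tabulate (hi t t≤n v)) + hamming (corner v) x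
          ≡⟨ cong₂ _+_ (sum-tabulate (hi t t≤n v)) (hamming-corner v x) ⟩
        ∑ (allFin k) (hi t t≤n v) + ∑ (allFin k) (λ j → 𝟙 (lookup (towards v x) j))
          ≡⟨ ∑-distrib-+ (allFin k) (hi t t≤n v) _ ⟨
        ∑ (allFin k) (λ j → hi t t≤n v j + 𝟙 (lookup (towards v x) j))
          ≤⟨ ∑-mono (allFin k) (λ {j} _ → hi-δ v (towards v x) j) ⟩
        ∑ (allFin k) (hi (suc t) t<n (next v x))
          ≡⟨ sum-tabulate (hi (suc t) t<n (next v x)) ⟨
        Vec.sum (Vec.tabulate (hi (suc t) t<n (next v x))) ∎
        where open ≤-Reasoning

      slack-next : ∀ v x → slack t t≤n x v ℤ.+ + hamming (corner v) x ℤ.≤ slack (suc t) t<n x (next v x)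
      slack-next v x = begin
        + H ℤ.- + X ℤ.+ + D  ≡⟨ [a-b]+c≡[a+c]-b (+ H) (+ X) (+ D) ⟩
        + H ℤ.+ + D ℤ.- + X  ≡⟨ cong (ℤ._- + X) (ℤ.pos-+ H D) ⟨
        + (H + D) ℤ.- + X    ≤⟨ ℤ.+-monoˡ-≤ (ℤ.- + X) (ℤ.+≤+ (sum-hi-next v x)) ⟩
        slack (suc t) t<n x (next v x) ∎
        where
        open ℤ.≤-Reasoning
        H X D : ℕ
        H = Vec.sum (Vec.tabulate (hi t t≤n v))
        X = Vec.sum x
        D = hamming (corner v) x
        [a-b]+c≡[a+c]-b : ∀ a b c → a ℤ.- b ℤ.+ c ≡ a ℤ.+ c ℤ.- b
        [a-b]+c≡[a+c]-b = ℤ-solve-∀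

      φ-step : ∀ x d → (∀ j → lookup x j ≤ t) → (∀ v → InBox t t≤n v x → d ≤ hamming (corner v) x) →
        φ t t≤n x ℤ.+ + d ℤ.≤ φ (suc t) t<n x
      φ-step x d x≤t d≤ with u , x∈u ← box-covers t t≤n x x≤t = φ+≤ t t≤n u x x∈u λ v x∈v → begin
        slack t t≤n x v ℤ.+ + d
          ≤⟨ ℤ.+-monoʳ-≤ (slack t t≤n x v) (ℤ.+≤+ (d≤ v x∈v)) ⟩
        slack t t≤n x v ℤ.+ + hamming (corner v) x
          ≤⟨ slack-next v x ⟩
        slack (suc t) t<n x (next v x)
          ≤⟨ slack≤φ (suc t) t<n (next v x) x (InBox-next v x x∈v) ⟩
        φ (suc t) t<n x ∎
        where open ℤ.≤-Reasoning

      module _ (N≤t : N ≤ t) (c : ℕ) where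

        near : Vec ℕ k → ℕ
        near x = ∑ (allFin (size t)) (λ u → 𝟙 (hamming (corner u) x <ᵇ c))

        isolated : Vec ℕ k → Bool
        isolated x = near x ≡ᵇ 0

        isolated-far : ∀ x u → c * 𝟙 (isolated x) ≤ hamming (corner u) x
        isolated-far x u with near x in near≡0
        ... | zero  = ≤-trans (≤-reflexive (*-identityʳ c))
                              (𝟙[<ᵇ]≡0⇒≥ (∑≡0⇒ (allFin (size t)) near≡0 (∈-allFin u)))
        ... | suc _ = ≤-trans (≤-reflexive (*-zeroʳ c)) z≤n

        ∑-near≤ : ∑ grid near ≤ width * 2 ^ k * suc N ^ (c ∸ 1)
        ∑-near≤ = begin
          ∑ grid near
            ≡⟨ ∑-comm grid (allFin (size t)) _ ⟩
          ∑ (allFin (size t)) (λ u → ballCard (upTo (suc N)) (corner u) c)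
            ≤⟨ ∑-mono (allFin (size t)) (λ {u} _ → ballCard≤ (upTo⁺ (suc N)) (corner u) c) ⟩
          ∑ (allFin (size t)) (const (2 ^ k * length (upTo (suc N)) ^ (c ∸ 1)))
            ≡⟨ ∑-const (allFin (size t)) _ ⟩
          length (allFin (size t)) * (2 ^ k * length (upTo (suc N)) ^ (c ∸ 1))
            ≡⟨ cong₂ (λ a b → a * (2 ^ k * b ^ (c ∸ 1)))
                     (length-tabulate {n = size t} id) (length-upTo (suc N)) ⟩
          size t * (2 ^ k * suc N ^ (c ∸ 1))
            ≤⟨ *-monoˡ-≤ _ (size≤width t t≤n) ⟩
          width * (2 ^ k * suc N ^ (c ∸ 1))
            ≡⟨ *-assoc width (2 ^ k) _ ⟨
          width * 2 ^ k * suc N ^ (c ∸ 1) ∎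
          where open ≤-Reasoning

        |grid|≤∑isolated+∑near : suc N ^ k ≤ ∑ grid (𝟙 ∘ isolated) + ∑ grid near
        |grid|≤∑isolated+∑near = begin
          suc N ^ k                                ≡⟨ cong (_^ k) (length-upTo (suc N)) ⟨
          length (upTo (suc N)) ^ k                ≡⟨ length-vecsOver (upTo (suc N)) k ⟨
          length grid                              ≡⟨ trans (∑-const grid 1) (*-identityʳ _) ⟨
          ∑ grid (const 1)                         ≤⟨ ∑-mono grid (λ {x} _ → 1≤𝟙[m≡ᵇ0]+m (near x)) ⟩
          ∑ grid (λ x → 𝟙 (isolated x) + near x)  ≡⟨ ∑-distrib-+ grid _ _ ⟩
          ∑ grid (𝟙 ∘ isolated) + ∑ grid near      ∎
          where open ≤-Reasoning

        Φ+c*∑isolated≤Φ : Φ t t≤n ℤ.+ + (c * ∑ grid (𝟙 ∘ isolated)) ℤ.≤ Φ (suc t) t<n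
        Φ+c*∑isolated≤Φ =
          subst (λ z → Φ t t≤n ℤ.+ + z ℤ.≤ Φ (suc t) t<n) (∑-distribˡ-* grid c (𝟙 ∘ isolated))
          (∑ℤ-+-mono grid λ {x} x∈ →
            φ-step x (c * 𝟙 (isolated x)) (λ j → ≤-trans (grid≤N x∈ j) N≤t) (λ u _ → isolated-far x u))

        Φ-increment : + c ℤ.* (+ (suc N ^ k) ℤ.- + (width * 2 ^ k * suc N ^ (c ∸ 1)))
                        ℤ.≤ Φ (suc t) t<n ℤ.- Φ t t≤n
        Φ-increment = begin
          + c ℤ.* (+ (suc N ^ k) ℤ.- + bad)
            ≤⟨ ℤ.*-monoˡ-≤-nonNeg (+ c) (i≤j+k⇒i-k≤j {k = + bad} |grid|≤good+bad) ⟩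
          + c ℤ.* + good
            ≡⟨ ℤ.pos-* c good ⟨
          + (c * good)
            ≤⟨ i+j≤k⇒j≤k-i Φ+c*∑isolated≤Φ ⟩
          Φ (suc t) t<n ℤ.- Φ t t≤n ∎
          where
          open ℤ.≤-Reasoning
          good bad : ℕ
          good = ∑ grid (𝟙 ∘ isolated)
          bad  = width * 2 ^ k * suc N ^ (c ∸ 1)
          |grid|≤good+bad : + (suc N ^ k) ℤ.≤ + good ℤ.+ + bad
          |grid|≤good+bad = ℤ.≤-trans
            (ℤ.+≤+ (≤-trans |grid|≤∑isolated+∑near (+-monoʳ-≤ good ∑-near≤)))
            (ℤ.≤-reflexive (ℤ.pos-+ good bad))

open import Defs
open import Data.Nat using (ℕ; suc; _≤_; _<_; _^_; _∸_)
open import Data.Nat.Properties using (<⇒≤)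
open import Data.Integer using (+_; _-_; _*_)
open import Data.Product using (_×_; _,_)
open import Relation.Binary.PropositionalEquality using (_≡_; refl)

lemma5p5 : (n k w : ℕ) → 1 ≤ k → 1 ≤ n → (P : ROBP n k) → AllReachable P →
    ROBP.width P ≡ w →
    let open Potential P in
      (+ 0 Data.Integer.≤ Φ N N≤n)
      × ((t : ℕ) → N ≤ t → (h : t < n) →
          (+ ceil9k/10 k) * (+ ((suc N) ^ k) - + (w Data.Nat.* 2 ^ k Data.Nat.* (suc N) ^ (ceil9k/10 k ∸ 1)))
            Data.Integer.≤ Φ (suc t) h - Φ t (<⇒≤ h))
lemma5p5 n k w _ _ P reachable refl =
  Φ-nonNeg , λ t N≤t t<n → Step.Φ-increment t t<n N≤t (ceil9k/10 k)
  where open Boxes P reachable
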